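{- Let $\kappa=\mathbf{Prop}_{T_1,U_1}\to\cdots\to\mathbf{Prop}_{T_m,U_m}\to\mathbf{Prop}_{T,U}$ be a refined type, and let $\mathcal{J}(\kappa)$ be the set of $J\subseteq\{1,\dots,m\}\times\{1,\dots,n\}$ such that for all $j,k$: if $k\in T_j$ then $(j,k)\notin J$, and if $k\in U_j$ then $(j,k)\in J$. Let $\mathbf{c}=(c_{i,j,k})_{i,j,k}$ and $\mathbf{c}'=(c'_{i,j,k})_{i,j,k}$ be elements of $[\![\kappa]\!]^{\mathrm{aff}}$. Then $\mathrm{fun}(\mathbf{c})\precsim_\kappa\mathrm{fun}(\mathbf{c}')$ if and only if for every $i\in\{1,\dots,n\}$ and every $J\in\mathcal{J}(\kappa)$, $c_{i,0,0}+\sum_{(j,k)\in J}c_{i,j,k}\le c'_{i,0,0}+\sum_{(j,k)\in J}c'_{i,j,k}$.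
   Context: Fix a Markov chain with state set $S=\{1,\dots,n\}$. $[\![\mathbf{Prop}]\!]$ is the set of functions $S\to[0,1]$ ordered pointwise ($\sqsubseteq$), higher types interpreted as monotone functions ordered pointwise. Refined types $\kappa::=\mathbf{Prop}_{T,U}\mid\mathbf{Prop}_{T,U}\to\kappa$ ($T,U\subseteq S$ disjoint); $\mathrm{tr}$ erases subscripts. $[\![\mathbf{Prop}_{T,U}]\!]=\{v\mid v|_T=0,v|_U=1\}$; for $\kappa$ as in the claim with $m\ge1$, $[\![\kappa]\!]$ is the set of $f\in[\![\mathbf{Prop}^m\to\mathbf{Prop}]\!]$ that are affine on $D=\prod_j[\![\mathbf{Prop}_{T_j,U_j}]\!]$ (for each state $i$ there are reals $a^i_0,a^i_{j,k}$ with $f\,v_1\cdots v_m\,i=a^i_0+\sum_{j,k}a^i_{j,k}v_j(k)$ on $D$) and satisfy $f\,v_1\cdots v_m\in[\![\mathbf{Prop}_{T,U}]\!]$ on $D$. $f\precsim_\kappa g$ iff $f\,v_1\cdots v_m\sqsubseteq g\,v_1\cdots v_m$ for every $(v_1,\dots,v_m)\in D$. Affine semantics: $[\![\mathbf{Prop}^m\to\mathbf{Prop}]\!]^{\mathrm{aff}}$ is the set of tuples $(c_{i,j,k})_{1\le i\le n,0\le j\le m,0\le k\le n}$ with entries in $[0,1]$ and $\sum_{j,k}c_{i,j,k}\le1$ for each $i$; $\mathrm{fun}(\mathbf{c})\,g_1\cdots g_m\,i=c_{i,0,0}+\sum_{j=1}^m\sum_{k=1}^n c_{i,j,k}g_j(k)$;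 $[\![\kappa]\!]^{\mathrm{aff}}=\{\mathbf{c}\in[\![\mathbf{Prop}^m\to\mathbf{Prop}]\!]^{\mathrm{aff}}\mid\mathrm{fun}(\mathbf{c})\in[\![\kappa]\!]\}$. -}

module Defs where

open import Level using (0ℓ)
open import Data.Nat using (ℕ; zero; suc)
open import Data.Fin using (Fin; zero; suc)
open import Data.Fin.Subset using (Subset; _∈_)
open import Data.Bool using (Bool; true; false; if_then_else_)
open import Data.Product using (Σ; ∃; _×_; _,_)
open import Data.Empty using (⊥)
open import Relation.Binary.PropositionalEquality using (_≡_; _≢_)
open import Relation.Binary.Core using (Rel)
open import Relation.Binary.Structures using (IsTotalOrder)
open import Algebra.Core using (Op₁; Op₂)
open import Algebra.Structures using (IsCommutativeRing)

-- The real numbers, axiomatised as a complete ordered field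
-- (unique up to isomorphism, so quantifying over all such structures
-- is quantifying over ℝ).

record RealField : Set₁ where
  infixl 6 _+_
  infixl 7 _*_
  infix 4 _≤_
  field
    Carrier : Set
    _+_ _*_ : Op₂ Carrier
    -_      : Op₁ Carrier
    0# 1#   : Carrier
    _≤_     : Rel Carrier 0ℓ
    isCommutativeRing : IsCommutativeRing _≡_ _+_ _*_ -_ 0# 1#
    0≢1     : 0# ≢ 1#
    inverse : ∀ x → x ≢ 0# → ∃ λ y → x * y ≡ 1#
    isTotalOrder : IsTotalOrder _≡_ _≤_
    +-monoˡ-≤ : ∀ {x y} z → x ≤ y → x + z ≤ y + z
    *-nonneg  : ∀ {x y} → 0# ≤ x → 0# ≤ y → 0# ≤ x * y
    sup : (P : Carrier → Set) → ∃ P → (∃ λ b → ∀ x → P x → x ≤ b) →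
          ∃ λ s → (∀ x → P x → x ≤ s) × (∀ b → (∀ x → P x → x ≤ b) → s ≤ b)

-- J ⊆ {1..m} × {1..n}, given by its characteristic function
Rel2 : ℕ → ℕ → Set
Rel2 n m = Fin m → Fin n → Bool

Disjoint : ∀ {n} → Subset n → Subset n → Set
Disjoint T U = ∀ k → k ∈ T → k ∈ U → ⊥

module _ (R : RealField) where
  open RealField R

  sumFin : ∀ {k} → (Fin k → Carrier) → Carrier
  sumFin {zero}  f = 0#
  sumFin {suc k} f = f zero + sumFin (λ i → f (suc i))

  InUnit : Carrier → Set
  InUnit x = (0# ≤ x) × (x ≤ 1#)

  -- elements of ⟦Prop⟧ : functions S → [0,1], S = Fin n
  IsProp : ∀ {n} → (Fin n → Carrier) → Set
  IsProp v = ∀ k → InUnit (v k)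

  _⊑_ : ∀ {n} → (Fin n → Carrier) → (Fin n → Carrier) → Set
  v ⊑ w = ∀ k → v k ≤ w k

  InPropTU : ∀ {n} → Subset n → Subset n → (Fin n → Carrier) → Set
  InPropTU T U v = IsProp v × (∀ k → k ∈ T → v k ≡ 0#) × (∀ k → k ∈ U → v k ≡ 1#)

  -- m-ary functions Prop^m → Prop, arguments given as an m-tuple
  Fun : ℕ → ℕ → Set
  Fun n m = (Fin m → Fin n → Carrier) → Fin n → Carrier

  AllProp : ∀ {n m} → (Fin m → Fin n → Carrier) → Set
  AllProp vs = ∀ j → IsProp (vs j)

  InPropFun : ∀ {n m} → Fun n m → Set
  InPropFun f = (∀ vs → AllProp vs → IsProp (f vs)) ×
                (∀ vs ws → AllProp vs → AllProp ws →
                   (∀ j → vs j ⊑ ws j) → f vs ⊑ f ws)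

  InD : ∀ {n m} → (Fin m → Subset n) → (Fin m → Subset n) →
        (Fin m → Fin n → Carrier) → Set
  InD Ts Us vs = ∀ j → InPropTU (Ts j) (Us j) (vs j)

  InKappa : ∀ {n m} → (Ts Us : Fin m → Subset n) → (T U : Subset n) → Fun n m → Set
  InKappa Ts Us T U f =
    InPropFun f ×
    (∀ i → Σ Carrier λ a₀ → Σ (Fin _ → Fin _ → Carrier) λ a →
       ∀ vs → InD Ts Us vs →
         f vs i ≡ a₀ + sumFin (λ j → sumFin (λ k → a j k * vs j k))) ×
    (∀ vs → InD Ts Us vs → InPropTU T U (f vs))

  Precsim : ∀ {n m} → (Ts Us : Fin m → Subset n) → Fun n m → Fun n m → Set
  Precsim Ts Us f g = ∀ vs → InD Ts Us vs → f vs ⊑ g vs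

  -- affine tuples (c_{i,j,k}), i ∈ S, j ∈ {0..m}, k ∈ {0..n}
  -- (index zero of Fin (suc m) / Fin (suc n) stands for 0, suc j for j)
  AffTuple : ℕ → ℕ → Set
  AffTuple n m = Fin n → Fin (suc m) → Fin (suc n) → Carrier

  InAff : ∀ {n m} → AffTuple n m → Set
  InAff c = (∀ i j k → InUnit (c i j k)) ×
            (∀ i → sumFin (λ j → sumFin (λ k → c i j k)) ≤ 1#)

  fun : ∀ {n m} → AffTuple n m → Fun n m
  fun c vs i = c i zero zero +
               sumFin (λ j → sumFin (λ k → c i (suc j) (suc k) * vs j k))

  InKappaAff : ∀ {n m} → (Ts Us : Fin m → Subset n) → (T U : Subset n) →
               AffTuple n m → Set
  InKappaAff Ts Us T U c = InAff c × InKappa Ts Us T U (fun c)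

  InCalJ : ∀ {n m} → (Ts Us : Fin m → Subset n) → Rel2 n m → Set
  InCalJ Ts Us J = ∀ j k → (k ∈ Ts j → J j k ≡ false) × (k ∈ Us j → J j k ≡ true)

  sumJ : ∀ {n m} → AffTuple n m → Fin n → Rel2 n m → Carrier
  sumJ c i J = c i zero zero +
               sumFin (λ j → sumFin (λ k → if J j k then c i (suc j) (suc k) else 0#))

-- An affine function is monotone in each coordinate with the sign of its coefficient, so on
-- the box D the difference fun c - fun c′, which is affine, is maximised at a vertex: round each
-- free coordinate v_j(k) to 1 if c_{i,j,k} ≥ c′_{i,j,k} and to 0 otherwise, while coordinates in
-- T_j or U_j are already 0 or 1. The vertices of D are exactly the 0/1 vectors of the J ∈ 𝒥(κ),
-- at which fun c evaluates to c_{i,0,0} + Σ_{(j,k) ∈ J} c_{i,j,k}.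
module Submission where

open import Defs
open import Algebra.Bundles using (CommutativeRing)
import Algebra.Properties.CommutativeSemigroup as CommutativeSemigroupProperties
import Algebra.Properties.Ring as RingProperties
open import Data.Bool using (Bool; true; false; if_then_else_)
open import Data.Empty using (⊥-elim)
open import Data.Fin using (Fin; zero; suc)
open import Data.Fin.Subset using (Subset; _∈_)
open import Data.Fin.Subset.Properties using (_∈?_)
open import Data.Nat using (ℕ; _≤_)
open import Data.Product using (Σ; _×_; _,_; proj₁; proj₂)
open import Data.Sum using (inj₁; inj₂)
open import Function.Base using (_∘_)
open import Function.Bundles using (_⇔_; mk⇔)
open import Relation.Binary.Bundles using (Poset)
open import Relation.Binary.PropositionalEquality using (_≡_; refl; sym; trans; cong; cong₂)
open import Relation.Binary.Structures using (IsTotalOrder)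
open import Relation.Nullary using (yes; no)

module _ (R : RealField) where
  open RealField R renaming (_≤_ to _≤ℝ_)
  open IsTotalOrder isTotalOrder using (total; reflexive; isPartialOrder) renaming (trans to ≤-trans)

  commutativeRing : CommutativeRing _ _
  commutativeRing = record { isCommutativeRing = isCommutativeRing }

  open CommutativeRing commutativeRing
    using (_-_; +-comm; +-assoc; +-identityˡ; -‿inverseʳ;
           *-comm; *-identityʳ; zeroʳ; distribʳ; ring; +-commutativeSemigroup)
  open RingProperties ring using (-1*x≈-x; -‿involutive; [y-z]x≈yx-zx; //-rightDividesˡ; //-rightDividesʳ)
  open CommutativeSemigroupProperties +-commutativeSemigroup using (interchange)

  poset : Poset _ _ _
  poset = record { isPartialOrder = isPartialOrder }

  open import Relation.Binary.Reasoning.PartialOrder poset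

  +-monoʳ-≤ : ∀ {x y} z → x ≤ℝ y → z + x ≤ℝ z + y
  +-monoʳ-≤ {x} {y} z x≤y = begin
    z + x ≡⟨ +-comm z x ⟩
    x + z ≤⟨ +-monoˡ-≤ z x≤y ⟩
    y + z ≡⟨ +-comm y z ⟩
    z + y ∎

  +-mono-≤ : ∀ {a b c d} → a ≤ℝ b → c ≤ℝ d → a + c ≤ℝ b + d
  +-mono-≤ {b = b} {c = c} a≤b c≤d = ≤-trans (+-monoˡ-≤ c a≤b) (+-monoʳ-≤ b c≤d)

  +-cancelʳ-≤ : ∀ {x y} z → x + z ≤ℝ y + z → x ≤ℝ y
  +-cancelʳ-≤ {x} {y} z x+z≤y+z = begin
    x         ≡⟨ //-rightDividesʳ z x ⟨
    x + z - z ≤⟨ +-monoˡ-≤ (- z) x+z≤y+z ⟩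
    y + z - z ≡⟨ //-rightDividesʳ z y ⟩
    y         ∎

  x≤y⇒0≤y-x : ∀ {x y} → x ≤ℝ y → 0# ≤ℝ y - x
  x≤y⇒0≤y-x {x} {y} x≤y = begin
    0#    ≡⟨ -‿inverseʳ x ⟨
    x - x ≤⟨ +-monoˡ-≤ (- x) x≤y ⟩
    y - x ∎

  0≤y-x⇒x≤y : ∀ {x y} → 0# ≤ℝ y - x → x ≤ℝ y
  0≤y-x⇒x≤y {x} {y} 0≤y-x = begin
    x           ≡⟨ +-identityˡ x ⟨
    0# + x      ≤⟨ +-monoˡ-≤ x 0≤y-x ⟩
    (y - x) + x ≡⟨ //-rightDividesˡ x y ⟩
    y           ∎

  *-monoʳ-≤-nonNeg : ∀ {x y v} → 0# ≤ℝ v → x ≤ℝ y → x * v ≤ℝ y * v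
  *-monoʳ-≤-nonNeg {x} {y} {v} 0≤v x≤y = 0≤y-x⇒x≤y (begin
    0#            ≤⟨ *-nonneg (x≤y⇒0≤y-x x≤y) 0≤v ⟩
    (y - x) * v   ≡⟨ [y-z]x≈yx-zx v y x ⟩
    y * v - x * v ∎)

  *-monoˡ-≤-nonNeg : ∀ {d x y} → 0# ≤ℝ d → x ≤ℝ y → d * x ≤ℝ d * y
  *-monoˡ-≤-nonNeg {d} {x} {y} 0≤d x≤y = begin
    d * x ≡⟨ *-comm d x ⟩
    x * d ≤⟨ *-monoʳ-≤-nonNeg 0≤d x≤y ⟩
    y * d ≡⟨ *-comm y d ⟩
    d * y ∎

  0≤1 : 0# ≤ℝ 1#
  0≤1 with total 0# 1#
  ... | inj₁ 0≤1 = 0≤1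
  ... | inj₂ 1≤0 = begin
    0#          ≤⟨ *-nonneg 0≤-1 0≤-1 ⟩
    - 1# * - 1# ≡⟨ -1*x≈-x (- 1#) ⟩
    - - 1#      ≡⟨ -‿involutive 1# ⟩
    1#          ∎
    where
    0≤-1 : 0# ≤ℝ - 1#
    0≤-1 = begin
      0#      ≤⟨ x≤y⇒0≤y-x 1≤0 ⟩
      0# - 1# ≡⟨ +-identityˡ (- 1#) ⟩
      - 1#    ∎

  cross-cancel-≤ : ∀ {a b c d x y} → a + b ≤ℝ c + d → x + d ≤ℝ y + b → a + x ≤ℝ c + y
  cross-cancel-≤ {a} {b} {c} {d} {x} {y} p q = +-cancelʳ-≤ (b + d) (begin
    (a + x) + (b + d) ≡⟨ interchange a b x d ⟨
    (a + b) + (x + d) ≤⟨ +-mono-≤ p q ⟩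
    (c + d) + (y + b) ≡⟨ interchange c d y b ⟩
    (c + y) + (d + b) ≡⟨ cong ((c + y) +_) (+-comm d b) ⟩
    (c + y) + (b + d) ∎)

  sumFin-cong : ∀ {k} {f g : Fin k → Carrier} → (∀ i → f i ≡ g i) → sumFin R f ≡ sumFin R g
  sumFin-cong {ℕ.zero}  f≡g = refl
  sumFin-cong {ℕ.suc k} f≡g = cong₂ _+_ (f≡g zero) (sumFin-cong (λ i → f≡g (suc i)))

  sumFin-mono-+ : ∀ {k} {f g f′ g′ : Fin k → Carrier} →
    (∀ i → f i + g i ≤ℝ f′ i + g′ i) →
    sumFin R f + sumFin R g ≤ℝ sumFin R f′ + sumFin R g′
  sumFin-mono-+ {ℕ.zero}  p = reflexive refl
  sumFin-mono-+ {ℕ.suc k} {f} {g} {f′} {g′} p = begin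
    (f zero + sumFin R (f ∘ suc)) + (g zero + sumFin R (g ∘ suc))
      ≡⟨ interchange (f zero) _ (g zero) _ ⟩
    (f zero + g zero) + (sumFin R (f ∘ suc) + sumFin R (g ∘ suc))
      ≤⟨ +-mono-≤ (p zero) (sumFin-mono-+ (p ∘ suc)) ⟩
    (f′ zero + g′ zero) + (sumFin R (f′ ∘ suc) + sumFin R (g′ ∘ suc))
      ≡⟨ interchange (f′ zero) (g′ zero) _ _ ⟩
    (f′ zero + sumFin R (f′ ∘ suc)) + (g′ zero + sumFin R (g′ ∘ suc)) ∎

  sumFin²-cong : ∀ {m k} {f g : Fin m → Fin k → Carrier} → (∀ j i → f j i ≡ g j i) →
    sumFin R (λ j → sumFin R (f j)) ≡ sumFin R (λ j → sumFin R (g j))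
  sumFin²-cong f≡g = sumFin-cong (λ j → sumFin-cong (f≡g j))

  sumFin²-mono-+ : ∀ {m k} {f g f′ g′ : Fin m → Fin k → Carrier} →
    (∀ j i → f j i + g j i ≤ℝ f′ j i + g′ j i) →
    sumFin R (λ j → sumFin R (f j)) + sumFin R (λ j → sumFin R (g j)) ≤ℝ
    sumFin R (λ j → sumFin R (f′ j)) + sumFin R (λ j → sumFin R (g′ j))
  sumFin²-mono-+ p = sumFin-mono-+ (λ j → sumFin-mono-+ (p j))

  keepIf : Bool → Carrier → Carrier
  keepIf b x = if b then x else 0#

  vertex : ∀ {n m} → Rel2 n m → Fin m → Fin n → Carrier
  vertex J j k = keepIf (J j k) 1#

  *-keepIf-1# : ∀ x b → x * keepIf b 1# ≡ keepIf b x
  *-keepIf-1# x true  = *-identityʳ x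
  *-keepIf-1# x false = zeroʳ x

  keepIf-1#-inUnit : ∀ b → InUnit R (keepIf b 1#)
  keepIf-1#-inUnit true  = 0≤1 , reflexive refl
  keepIf-1#-inUnit false = reflexive refl , 0≤1

  fun-vertex : ∀ {n m} (c : AffTuple R n m) i J → fun R c (vertex J) i ≡ sumJ R c i J
  fun-vertex c i J = cong (c i zero zero +_) (sumFin²-cong (λ j k → *-keepIf-1# _ (J j k)))

  vertex∈D : ∀ {n m} {Ts Us : Fin m → Subset n} {J} → InCalJ R Ts Us J → InD R Ts Us (vertex J)
  vertex∈D {J = J} J∈𝒥 j =
    (λ k → keepIf-1#-inUnit (J j k)) ,
    (λ k k∈T → cong (λ b → keepIf b 1#) (proj₁ (J∈𝒥 j k) k∈T)) ,
    (λ k k∈U → cong (λ b → keepIf b 1#) (proj₂ (J∈𝒥 j k) k∈U))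

  -- (a - a′) v ≤ (a - a′) [b], written without subtraction.
  RoundsUp : Carrier → Carrier → Carrier → Bool → Set
  RoundsUp a a′ v b = a * v + keepIf b a′ ≤ℝ a′ * v + keepIf b a

  roundsUp-at-1# : ∀ {a a′ v} → v ≡ 1# → RoundsUp a a′ v true
  roundsUp-at-1# {a} {a′} refl = reflexive (begin-equality
    a * 1# + a′ ≡⟨ cong (_+ a′) (*-identityʳ a) ⟩
    a + a′      ≡⟨ +-comm a a′ ⟩
    a′ + a      ≡⟨ cong (_+ a) (*-identityʳ a′) ⟨
    a′ * 1# + a ∎)

  roundsUp-at-0# : ∀ {a a′ v} → v ≡ 0# → RoundsUp a a′ v false
  roundsUp-at-0# {a} {a′} refl = reflexive (cong (_+ 0#) (trans (zeroʳ a) (sym (zeroʳ a′))))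

  roundsUp-false : ∀ {a a′ v} → a ≤ℝ a′ → 0# ≤ℝ v → RoundsUp a a′ v false
  roundsUp-false a≤a′ 0≤v = +-monoˡ-≤ 0# (*-monoʳ-≤-nonNeg 0≤v a≤a′)

  roundsUp-true : ∀ {a a′ v} → a′ ≤ℝ a → v ≤ℝ 1# → RoundsUp a a′ v true
  roundsUp-true {a} {a′} {v} a′≤a v≤1 = begin
    a * v + a′                      ≡⟨ cong (λ t → t * v + a′) (//-rightDividesˡ a′ a) ⟨
    (a - a′ + a′) * v + a′          ≡⟨ cong (_+ a′) (distribʳ v (a - a′) a′) ⟩
    ((a - a′) * v + a′ * v) + a′    ≡⟨ +-assoc _ _ a′ ⟩
    (a - a′) * v + (a′ * v + a′)    ≤⟨ +-monoˡ-≤ _ (*-monoˡ-≤-nonNeg (x≤y⇒0≤y-x a′≤a) v≤1) ⟩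
    (a - a′) * 1# + (a′ * v + a′)   ≡⟨ cong₂ _+_ (*-identityʳ (a - a′)) (+-comm (a′ * v) a′) ⟩
    (a - a′) + (a′ + a′ * v)        ≡⟨ +-assoc (a - a′) a′ _ ⟨
    (a - a′ + a′) + a′ * v          ≡⟨ cong (_+ a′ * v) (//-rightDividesˡ a′ a) ⟩
    a + a′ * v                      ≡⟨ +-comm a (a′ * v) ⟩
    a′ * v + a                      ∎

  roundCoordinate : ∀ {n} {T U : Subset n} {v : Fin n → Carrier} →
    Disjoint T U → InPropTU R T U v → ∀ k a a′ →
    Σ Bool λ b → ((k ∈ T → b ≡ false) × (k ∈ U → b ≡ true)) × RoundsUp a a′ (v k) b
  roundCoordinate {T = T} {U} T∩U=∅ (v∈[0,1] , v|T≡0 , v|U≡1) k a a′ with k ∈? U | k ∈? T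
  ... | yes k∈U | _ =
    true , ((λ k∈T → ⊥-elim (T∩U=∅ k k∈T k∈U)) , λ _ → refl) , roundsUp-at-1# (v|U≡1 k k∈U)
  ... | no k∉U | yes k∈T =
    false , ((λ _ → refl) , λ k∈U → ⊥-elim (k∉U k∈U)) , roundsUp-at-0# (v|T≡0 k k∈T)
  ... | no k∉U | no k∉T with total a a′
  ...   | inj₁ a≤a′ =
    false , ((λ _ → refl) , λ k∈U → ⊥-elim (k∉U k∈U)) , roundsUp-false a≤a′ (proj₁ (v∈[0,1] k))
  ...   | inj₂ a′≤a =
    true , ((λ k∈T → ⊥-elim (k∉T k∈T)) , λ _ → refl) , roundsUp-true a′≤a (proj₂ (v∈[0,1] k))

  roundToVertex : ∀ {n m} {Ts Us : Fin m → Subset n} {vs} →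
    (∀ j → Disjoint (Ts j) (Us j)) → InD R Ts Us vs → (a a′ : Fin m → Fin n → Carrier) →
    Σ (Rel2 n m) λ J → InCalJ R Ts Us J × (∀ j k → RoundsUp (a j k) (a′ j k) (vs j k) (J j k))
  roundToVertex {Ts = Ts} {Us} {vs} disjoint vs∈D a a′ =
    (λ j k → proj₁ (rounding j k)) ,
    (λ j k → proj₁ (proj₂ (rounding j k))) ,
    (λ j k → proj₂ (proj₂ (rounding j k)))
    where
    rounding : ∀ j k → Σ Bool λ b →
      ((k ∈ Ts j → b ≡ false) × (k ∈ Us j → b ≡ true)) × RoundsUp (a j k) (a′ j k) (vs j k) b
    rounding j k = roundCoordinate (disjoint j) (vs∈D j) k (a j k) (a′ j k)

  precsim⇒sumJ-≤ : ∀ {n m} {Ts Us : Fin m → Subset n} (c c′ : AffTuple R n m) →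
    Precsim R Ts Us (fun R c) (fun R c′) →
    ∀ i J → InCalJ R Ts Us J → sumJ R c i J ≤ℝ sumJ R c′ i J
  precsim⇒sumJ-≤ c c′ c≾c′ i J J∈𝒥 = begin
    sumJ R c i J            ≡⟨ fun-vertex c i J ⟨
    fun R c (vertex J) i    ≤⟨ c≾c′ (vertex J) (vertex∈D J∈𝒥) i ⟩
    fun R c′ (vertex J) i   ≡⟨ fun-vertex c′ i J ⟩
    sumJ R c′ i J           ∎

  sumJ-≤⇒precsim : ∀ {n m} {Ts Us : Fin m → Subset n} → (∀ j → Disjoint (Ts j) (Us j)) →
    (c c′ : AffTuple R n m) →
    (∀ i J → InCalJ R Ts Us J → sumJ R c i J ≤ℝ sumJ R c′ i J) →
    Precsim R Ts Us (fun R c) (fun R c′)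
  sumJ-≤⇒precsim disjoint c c′ sumJ-≤ vs vs∈D i
    with roundToVertex disjoint vs∈D (λ j k → c i (suc j) (suc k)) (λ j k → c′ i (suc j) (suc k))
  ... | J , J∈𝒥 , roundsUp = cross-cancel-≤ (sumJ-≤ i J J∈𝒥) (sumFin²-mono-+ roundsUp)

lemma5p18 : (R : RealField) (n m : ℕ) → 1 ≤ m →
    (Ts Us : Fin m → Subset n) (T U : Subset n) →
    (∀ j → Disjoint (Ts j) (Us j)) → Disjoint T U →
    (c c′ : AffTuple R n m) →
    InKappaAff R Ts Us T U c → InKappaAff R Ts Us T U c′ →
    Precsim R Ts Us (fun R c) (fun R c′)
    ⇔ (∀ (i : Fin n) (J : Rel2 n m) → InCalJ R Ts Us J →
    RealField._≤_ R (sumJ R c i J) (sumJ R c′ i J))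
lemma5p18 R n m _ Ts Us T U disjoint _ c c′ _ _ =
  mk⇔ (precsim⇒sumJ-≤ R c c′) (sumJ-≤⇒precsim R disjoint c c′)
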